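{- Let $s\ge2$ and $1\le\ell\le\binom{s}{2}$ be integers, and let $m_1,\dots,m_\ell$ be integers with $2\le m_j\le s$ for all $j$ and $\sum_{j=1}^{\ell}\binom{m_j}{2}=\binom{s}{2}$. Then \[\sum_{j=1}^{\ell}\big(m_j-1-\log_3 m_j\big)\ge s-1-\log_3 s,\] with equality if and only if $\ell=1$ and $m_1=s$. -}

module Defs where

open import Data.Nat using (ℕ; zero; suc; _+_; _*_)
open import Data.Fin using (Fin; zero; suc)

sumF : (ℓ : ℕ) → (Fin ℓ → ℕ) → ℕ
sumF zero    f = 0
sumF (suc ℓ) f = f zero + sumF ℓ (λ j → f (suc j))

prodF : (ℓ : ℕ) → (Fin ℓ → ℕ) → ℕ
prodF zero    f = 1
prodF (suc ℓ) f = f zero * prodF ℓ (λ j → f (suc j))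

{-# OPTIONS --safe #-}

-- Put w m = m (m - 1) and φ m = (m - 1 - log₃ m) / w m. The hypothesis says Σ w mⱼ = w s
-- and the claim says Σ w mⱼ φ mⱼ ≥ w s φ s, so it follows termwise once φ is strictly
-- decreasing on m ≥ 2, with equality only if every mⱼ = s, which forces ℓ = 1. For
-- consecutive arguments φ k > φ (k + 1) amounts to k ^ (k + 1) < 3 ^ (k - 1) (k + 1) ^ (k - 1).
-- Logarithms are avoided by working with 3 ^ (- φ m) = (m / 3 ^ (m - 1)) ^ (1 / w m) and
-- comparing such roots after raising them to a common power.
module Submission where

open import Defs
open import Data.Nat
  using (ℕ; zero; suc; _+_; _*_; _∸_; _^_; _≤_; _<_; z≤n; s≤s; z<s; NonZero; >-nonZero)
open import Data.Nat.Properties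
open import Data.Nat.Combinatorics using (_C_; nC1≡n; nCk+nC[k+1]≡[n+1]C[k+1])
open import Data.Nat.Tactic.RingSolver using (solve-∀)
open import Data.Fin using (Fin; zero; suc)
open import Data.Product using (_×_; _,_; proj₁; proj₂)
open import Data.Sum using (inj₁; inj₂)
open import Relation.Nullary using (yes; no; contradiction)
open import Relation.Nullary.Decidable using (from-yes)
open import Relation.Binary.PropositionalEquality
  using (_≡_; _≢_; refl; sym; trans; cong; cong₂; subst; subst₂; module ≡-Reasoning)
open import Function using (_∘_; _$_)
open import Function.Bundles using (_⇔_; mk⇔)
open import Algebra.Properties.CommutativeSemigroup *-commutativeSemigroup
  using (interchange; xy∙z≈xz∙y)

^-distribʳ-* : ∀ m n o → (m * n) ^ o ≡ m ^ o * n ^ o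
^-distribʳ-* m n zero    = refl
^-distribʳ-* m n (suc o) =
  trans (cong (m * n *_) (^-distribʳ-* m n o)) (interchange m n (m ^ o) (n ^ o))

^-comm : ∀ m n o → (m ^ n) ^ o ≡ (m ^ o) ^ n
^-comm m n o = begin
  (m ^ n) ^ o ≡⟨ ^-*-assoc m n o ⟩
  m ^ (n * o) ≡⟨ cong (m ^_) (*-comm n o) ⟩
  m ^ (o * n) ≡⟨ ^-*-assoc m o n ⟨
  (m ^ o) ^ n ∎
  where open ≡-Reasoning

^-monoˡ-<-* : ∀ n .{{_ : NonZero n}} {a b c d} → a * b < c * d → a ^ n * b ^ n < c ^ n * d ^ n
^-monoˡ-<-* n {a} {b} {c} {d} =
  subst₂ _<_ (^-distribʳ-* a b n) (^-distribʳ-* c d n) ∘ ^-monoˡ-< n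

^-cancelʳ-< : ∀ n {a b} → a ^ n < b ^ n → a < b
^-cancelʳ-< n {a} {b} aⁿ<bⁿ with a <? b
... | yes a<b = a<b
... | no  a≮b = contradiction aⁿ<bⁿ (≤⇒≯ (^-monoˡ-≤ n (≮⇒≥ a≮b)))

^-cancelʳ-≤ : ∀ n .{{_ : NonZero n}} {a b} → a ^ n ≤ b ^ n → a ≤ b
^-cancelʳ-≤ n {a} {b} aⁿ≤bⁿ with a ≤? b
... | yes a≤b = a≤b
... | no  a≰b = contradiction aⁿ≤bⁿ (<⇒≱ (^-monoˡ-< n (≰⇒> a≰b)))

*-cross-<-trans : ∀ {a b c d e f} → a * d < b * c → c * f < d * e → a * f < b * e
*-cross-<-trans {a} {b} {c} {d} {e} {f} ad<bc cf<de =
  *-cancelʳ-< (c * d) (a * f) (b * e)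
    (subst₂ _<_ (regroup a d c f) (trans (regroup b c d e) (cong (b * e *_) (*-comm d c)))
      (*-mono-< ad<bc cf<de))
  where
  regroup : ∀ w x y z → w * x * (y * z) ≡ w * z * (y * x)
  regroup = solve-∀

-- The positive real (num / den) ^ (1 / deg); two of them are compared by raising both
-- to the product of their degrees and clearing denominators.
record Root : Set where
  constructor _/_^1/_
  field
    num den deg : ℕ

open Root

record _<ᴿ_ (r₁ r₂ : Root) : Set where
  constructor cross-<
  field
    cross-<⁻¹ : num r₁ ^ deg r₂ * den r₂ ^ deg r₁ < den r₁ ^ deg r₂ * num r₂ ^ deg r₁

record _≤ᴿ_ (r₁ r₂ : Root) : Set where
  constructor cross-≤
  field
    cross-≤⁻¹ : num r₁ ^ deg r₂ * den r₂ ^ deg r₁ ≤ den r₁ ^ deg r₂ * num r₂ ^ deg r₁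

open _<ᴿ_
open _≤ᴿ_

≤ᴿ-refl : ∀ {r} → r ≤ᴿ r
≤ᴿ-refl {y / x ^1/ u} = cross-≤ (≤-reflexive (*-comm (y ^ u) (x ^ u)))

<ᴿ⇒≤ᴿ : ∀ {r₁ r₂} → r₁ <ᴿ r₂ → r₁ ≤ᴿ r₂
<ᴿ⇒≤ᴿ (cross-< p) = cross-≤ (<⇒≤ p)

<ᴿ-trans : ∀ {r₁ r₂ r₃} .{{_ : NonZero (deg r₁)}} .{{_ : NonZero (deg r₃)}} →
           r₁ <ᴿ r₂ → r₂ <ᴿ r₃ → r₁ <ᴿ r₃
<ᴿ-trans {y₁ / x₁ ^1/ u} {y₂ / x₂ ^1/ v} {y₃ / x₃ ^1/ w} (cross-< r₁<r₂) (cross-< r₂<r₃) =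
  cross-< (^-cancelʳ-< v (subst₂ _<_ (powᵛ y₁ x₃) (powᵛ x₁ y₃)
    (*-cross-<-trans {a = (y₁ ^ v) ^ w} {b = (x₁ ^ v) ^ w} r₁<r₂ʷ r₂<r₃ᵘ)))
  where
  r₁<r₂ʷ : (y₁ ^ v) ^ w * (x₂ ^ u) ^ w < (x₁ ^ v) ^ w * (y₂ ^ u) ^ w
  r₁<r₂ʷ = ^-monoˡ-<-* w r₁<r₂
  r₂<r₃ᵘ : (y₂ ^ u) ^ w * (x₃ ^ v) ^ u < (x₂ ^ u) ^ w * (y₃ ^ v) ^ u
  r₂<r₃ᵘ = subst₂ _<_ (cong (_* _) (^-comm y₂ w u)) (cong (_* _) (^-comm x₂ w u))
                      (^-monoˡ-<-* u r₂<r₃)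
  powᵛ : ∀ a b → (a ^ v) ^ w * (b ^ v) ^ u ≡ (a ^ w * b ^ u) ^ v
  powᵛ a b = trans (cong₂ _*_ (^-comm a v w) (^-comm b v u)) (sym (^-distribʳ-* _ _ v))

<ᴿ-scale : ∀ c .{{_ : NonZero c}} {y₁ x₁ u y₂ x₂ v} →
           (y₁ / x₁ ^1/ u) <ᴿ (y₂ / x₂ ^1/ v) → (y₁ / x₁ ^1/ (u * c)) <ᴿ (y₂ / x₂ ^1/ (v * c))
<ᴿ-scale c {y₁} {x₁} {u} {y₂} {x₂} {v} (cross-< r₁<r₂) =
  cross-< (subst₂ _<_ (cong₂ _*_ (^-*-assoc y₁ v c) (^-*-assoc x₂ u c))
                      (cong₂ _*_ (^-*-assoc x₁ v c) (^-*-assoc y₂ u c))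
                      (^-monoˡ-<-* c r₁<r₂))

[4+k]*[4+k]<3^[3+k] : ∀ k → (4 + k) * (4 + k) < 3 ^ (3 + k)
[4+k]*[4+k]<3^[3+k] zero    = from-yes (16 <? 27)
[4+k]*[4+k]<3^[3+k] (suc k) = begin-strict
  (5 + k) * (5 + k)       ≤⟨ m≤n+m ((5 + k) * (5 + k)) d ⟩
  d + (5 + k) * (5 + k)   ≡⟨ expand k ⟩
  3 * ((4 + k) * (4 + k)) <⟨ *-monoʳ-< 3 ([4+k]*[4+k]<3^[3+k] k) ⟩
  3 * 3 ^ (3 + k)         ∎
  where
  open ≤-Reasoning
  d : ℕ
  d = 23 + 14 * k + 2 * (k * k)
  expand : ∀ j → 23 + 14 * j + 2 * (j * j) + (5 + j) * (5 + j) ≡ 3 * ((4 + j) * (4 + j))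
  expand = solve-∀

[2+k]^[3+k]<3^[1+k]*[3+k]^[1+k] : ∀ k → (2 + k) ^ (3 + k) < 3 ^ (1 + k) * (3 + k) ^ (1 + k)
[2+k]^[3+k]<3^[1+k]*[3+k]^[1+k] 0             = from-yes (8 <? 9)
[2+k]^[3+k]<3^[1+k]*[3+k]^[1+k] 1             = from-yes (81 <? 144)
[2+k]^[3+k]<3^[1+k]*[3+k]^[1+k] (suc (suc k)) = begin-strict
  n * (n * n ^ (3 + k))       ≡⟨ *-assoc n n (n ^ (3 + k)) ⟨
  n * n * n ^ (3 + k)         ≤⟨ *-monoʳ-≤ (n * n) (^-monoˡ-≤ (3 + k) (n≤1+n n)) ⟩
  n * n * (5 + k) ^ (3 + k)   <⟨ *-monoˡ-< _ {{m^n≢0 (5 + k) (3 + k)}} ([4+k]*[4+k]<3^[3+k] k) ⟩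
  3 ^ (3 + k) * (5 + k) ^ (3 + k) ∎
  where
  open ≤-Reasoning
  n : ℕ
  n = 4 + k

ψ : ℕ → Root
ψ m = m / 3 ^ (m ∸ 1) ^1/ (m * (m ∸ 1))

ψ-deg-nonZero : ∀ {m} → 2 ≤ m → NonZero (deg (ψ m))
ψ-deg-nonZero {suc (suc _)} (s≤s (s≤s z≤n)) = _

ψ-<ᴿ-suc : ∀ {n} → 2 ≤ n → ψ n <ᴿ ψ (suc n)
ψ-<ᴿ-suc {suc (suc k)} (s≤s (s≤s z≤n)) =
  subst (λ d → ((2 + k) / 3 ^ (1 + k) ^1/ d) <ᴿ ψ (3 + k)) (*-comm (1 + k) (2 + k))
        (<ᴿ-scale (2 + k) root)
  where
  open ≤-Reasoning
  T U : ℕ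
  T = (3 ^ (2 + k)) ^ (1 + k)
  U = (3 + k) ^ (1 + k)
  root : ((2 + k) / 3 ^ (1 + k) ^1/ (1 + k)) <ᴿ ((3 + k) / 3 ^ (2 + k) ^1/ (3 + k))
  root = cross-< $ begin-strict
    (2 + k) ^ (3 + k) * T       <⟨ *-monoˡ-< T {{m^n≢0 _ (1 + k) {{m^n≢0 3 (2 + k)}}}}
                                     ([2+k]^[3+k]<3^[1+k]*[3+k]^[1+k] k) ⟩
    3 ^ (1 + k) * U * T         ≡⟨ xy∙z≈xz∙y (3 ^ (1 + k)) U T ⟩
    3 ^ (1 + k) * T * U         ≡⟨ cong (λ t → 3 ^ (1 + k) * t * U) (^-comm 3 (2 + k) (1 + k)) ⟩
    (3 ^ (1 + k)) ^ (3 + k) * U ∎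

ψ-<ᴿ : ∀ {a b} → 2 ≤ a → a < b → ψ a <ᴿ ψ b
ψ-<ᴿ {a} {suc b} 2≤a (s≤s a≤b) with m≤n⇒m<n∨m≡n a≤b
... | inj₂ refl = ψ-<ᴿ-suc 2≤a
... | inj₁ a<b  = <ᴿ-trans {{ψ-deg-nonZero 2≤a}} {{ψ-deg-nonZero (m≤n⇒m≤1+n 2≤b)}}
                           (ψ-<ᴿ 2≤a a<b) (ψ-<ᴿ-suc 2≤b)
  where
  2≤b : 2 ≤ b
  2≤b = ≤-trans 2≤a (<⇒≤ a<b)

ψ-≤ᴿ : ∀ {a b} → 2 ≤ a → a ≤ b → ψ a ≤ᴿ ψ b
ψ-≤ᴿ {a} {b} 2≤a a≤b with m≤n⇒m<n∨m≡n a≤b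
... | inj₁ a<b  = <ᴿ⇒≤ᴿ (ψ-<ᴿ 2≤a a<b)
... | inj₂ refl = ≤ᴿ-refl

sumF-cong : ∀ ℓ {f g : Fin ℓ → ℕ} → (∀ j → f j ≡ g j) → sumF ℓ f ≡ sumF ℓ g
sumF-cong zero    f≗g = refl
sumF-cong (suc ℓ) f≗g = cong₂ _+_ (f≗g zero) (sumF-cong ℓ (f≗g ∘ suc))

sumF-*ʳ : ∀ ℓ (f : Fin ℓ → ℕ) c → sumF ℓ (λ j → f j * c) ≡ sumF ℓ f * c
sumF-*ʳ zero    f c = refl
sumF-*ʳ (suc ℓ) f c =
  trans (cong (f zero * c +_) (sumF-*ʳ ℓ (f ∘ suc) c)) (sym (*-distribʳ-+ c (f zero) _))

sumF-const : ∀ ℓ c → sumF ℓ (λ _ → c) ≡ ℓ * c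
sumF-const zero    c = refl
sumF-const (suc ℓ) c = cong (c +_) (sumF-const ℓ c)

prodF-^-sumF : ∀ ℓ b (e : Fin ℓ → ℕ) → prodF ℓ (λ j → b ^ e j) ≡ b ^ sumF ℓ e
prodF-^-sumF zero    b e = refl
prodF-^-sumF (suc ℓ) b e =
  trans (cong (b ^ e zero *_) (prodF-^-sumF ℓ b (e ∘ suc))) (sym (^-distribˡ-+-* b (e zero) _))

prodF-^-*-^ : ∀ ℓ (y w : Fin ℓ → ℕ) x n →
              prodF ℓ (λ j → y j ^ n * x ^ w j) ≡ prodF ℓ y ^ n * x ^ sumF ℓ w
prodF-^-*-^ zero    y w x n = sym (trans (*-identityʳ (1 ^ n)) (^-zeroˡ n))
prodF-^-*-^ (suc ℓ) y w x n = begin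
  y zero ^ n * x ^ w zero * prodF ℓ (λ j → y (suc j) ^ n * x ^ w (suc j))
    ≡⟨ cong (y zero ^ n * x ^ w zero *_) (prodF-^-*-^ ℓ (y ∘ suc) (w ∘ suc) x n) ⟩
  y zero ^ n * x ^ w zero * (prodF ℓ (y ∘ suc) ^ n * x ^ sumF ℓ (w ∘ suc))
    ≡⟨ interchange (y zero ^ n) (x ^ w zero) _ _ ⟩
  y zero ^ n * prodF ℓ (y ∘ suc) ^ n * (x ^ w zero * x ^ sumF ℓ (w ∘ suc))
    ≡⟨ cong₂ _*_ (^-distribʳ-* (y zero) _ n) (^-distribˡ-+-* x (w zero) _) ⟨
  (y zero * prodF ℓ (y ∘ suc)) ^ n * x ^ (w zero + sumF ℓ (w ∘ suc)) ∎
  where open ≡-Reasoning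

prodF-pos : ∀ ℓ {f : Fin ℓ → ℕ} → (∀ j → 0 < f j) → 0 < prodF ℓ f
prodF-pos zero    f>0 = z<s
prodF-pos (suc ℓ) f>0 = *-mono-< (f>0 zero) (prodF-pos ℓ (f>0 ∘ suc))

prodF-mono-≤ : ∀ ℓ {f g : Fin ℓ → ℕ} → (∀ j → f j ≤ g j) → prodF ℓ f ≤ prodF ℓ g
prodF-mono-≤ zero    f≤g = ≤-refl
prodF-mono-≤ (suc ℓ) f≤g = *-mono-≤ (f≤g zero) (prodF-mono-≤ ℓ (f≤g ∘ suc))

prodF-mono-< : ∀ ℓ {f g : Fin ℓ → ℕ} → (∀ j → 0 < g j) → (∀ j → f j ≤ g j) →
               ∀ i → f i < g i → prodF ℓ f < prodF ℓ g
prodF-mono-< (suc ℓ) {f} {g} g>0 f≤g zero f₀<g₀ = begin-strict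
  f zero * prodF ℓ (f ∘ suc) ≤⟨ *-monoʳ-≤ (f zero) (prodF-mono-≤ ℓ (f≤g ∘ suc)) ⟩
  f zero * prodF ℓ (g ∘ suc) <⟨ *-monoˡ-< _ {{>-nonZero (prodF-pos ℓ (g>0 ∘ suc))}} f₀<g₀ ⟩
  g zero * prodF ℓ (g ∘ suc) ∎
  where open ≤-Reasoning
prodF-mono-< (suc ℓ) {f} {g} g>0 f≤g (suc i) fᵢ<gᵢ = begin-strict
  f zero * prodF ℓ (f ∘ suc) ≤⟨ *-monoˡ-≤ _ (f≤g zero) ⟩
  g zero * prodF ℓ (f ∘ suc) <⟨ *-monoʳ-< _ {{>-nonZero (g>0 zero)}}
                                  (prodF-mono-< ℓ (g>0 ∘ suc) (f≤g ∘ suc) i fᵢ<gᵢ) ⟩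
  g zero * prodF ℓ (g ∘ suc) ∎
  where open ≤-Reasoning

prodF-cross : ∀ ℓ (y w : Fin ℓ → ℕ) x {W} → sumF ℓ w ≡ W →
              prodF ℓ (λ j → y j ^ W * x ^ w j) ≡ (prodF ℓ y * x) ^ W
prodF-cross ℓ y w x {W} Σw≡W =
  trans (prodF-^-*-^ ℓ y w x W)
        (trans (cong (λ e → prodF ℓ y ^ W * x ^ e) Σw≡W) (sym (^-distribʳ-* (prodF ℓ y) x W)))

prodF-≤ᴿ : ∀ ℓ {y x w : Fin ℓ → ℕ} {Y X W} .{{_ : NonZero W}} → sumF ℓ w ≡ W →
           (∀ j → (y j / x j ^1/ w j) ≤ᴿ (Y / X ^1/ W)) → prodF ℓ y * X ≤ prodF ℓ x * Y
prodF-≤ᴿ ℓ {y} {x} {w} {Y} {X} {W} Σw≡W rⱼ≤R =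
  ^-cancelʳ-≤ W (subst₂ _≤_ (prodF-cross ℓ y w X Σw≡W) (prodF-cross ℓ x w Y Σw≡W)
                            (prodF-mono-≤ ℓ (cross-≤⁻¹ ∘ rⱼ≤R)))

prodF-<ᴿ : ∀ ℓ {y x w : Fin ℓ → ℕ} {Y X W} → sumF ℓ w ≡ W → (∀ j → 0 < x j) → 0 < Y →
           (∀ j → (y j / x j ^1/ w j) ≤ᴿ (Y / X ^1/ W)) →
           ∀ i → (y i / x i ^1/ w i) <ᴿ (Y / X ^1/ W) → prodF ℓ y * X < prodF ℓ x * Y
prodF-<ᴿ ℓ {y} {x} {w} {Y} {X} {W} Σw≡W x>0 Y>0 rⱼ≤R i rᵢ<R =
  ^-cancelʳ-< W (subst₂ _<_ (prodF-cross ℓ y w X Σw≡W) (prodF-cross ℓ x w Y Σw≡W)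
                            (prodF-mono-< ℓ rhs>0 (cross-≤⁻¹ ∘ rⱼ≤R) i (cross-<⁻¹ rᵢ<R)))
  where
  rhs>0 : ∀ j → 0 < x j ^ W * Y ^ w j
  rhs>0 j = *-mono-< (m^n>0 (x j) {{>-nonZero (x>0 j)}} W) (m^n>0 Y {{>-nonZero Y>0}} (w j))

[nC2]*2≡n*[n∸1] : ∀ n → (n C 2) * 2 ≡ n * (n ∸ 1)
[nC2]*2≡n*[n∸1] 0               = refl
[nC2]*2≡n*[n∸1] 1               = refl
[nC2]*2≡n*[n∸1] (suc n@(suc k)) = begin
  (suc n C 2) * 2     ≡⟨ cong (_* 2) (nCk+nC[k+1]≡[n+1]C[k+1] n 1) ⟨
  (n C 1 + n C 2) * 2 ≡⟨ cong (λ c → (c + n C 2) * 2) (nC1≡n n) ⟩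
  (n + n C 2) * 2     ≡⟨ *-distribʳ-+ 2 n (n C 2) ⟩
  n * 2 + (n C 2) * 2 ≡⟨ cong (n * 2 +_) ([nC2]*2≡n*[n∸1] n) ⟩
  n * 2 + n * k       ≡⟨ *-distribˡ-+ n 2 k ⟨
  n * suc n           ≡⟨ *-comm n (suc n) ⟩
  suc n * n           ∎
  where open ≡-Reasoning

sumF-[nC2]≡⇒sumF-n*[n∸1]≡ : ∀ ℓ (m : Fin ℓ → ℕ) s → sumF ℓ (λ j → m j C 2) ≡ s C 2 →
                             sumF ℓ (λ j → m j * (m j ∸ 1)) ≡ s * (s ∸ 1)
sumF-[nC2]≡⇒sumF-n*[n∸1]≡ ℓ m s Σ[mⱼC2]≡sC2 = begin
  sumF ℓ (λ j → m j * (m j ∸ 1)) ≡⟨ sumF-cong ℓ ([nC2]*2≡n*[n∸1] ∘ m) ⟨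
  sumF ℓ (λ j → (m j C 2) * 2)   ≡⟨ sumF-*ʳ ℓ (λ j → m j C 2) 2 ⟩
  sumF ℓ (λ j → m j C 2) * 2     ≡⟨ cong (_* 2) Σ[mⱼC2]≡sC2 ⟩
  (s C 2) * 2                    ≡⟨ [nC2]*2≡n*[n∸1] s ⟩
  s * (s ∸ 1)                    ∎
  where open ≡-Reasoning

sumF≡c∧all≡c⇒ℓ≡1 : ∀ ℓ (f : Fin ℓ → ℕ) c .{{_ : NonZero c}} →
                    sumF ℓ f ≡ c → (∀ j → f j ≡ c) → ℓ ≡ 1
sumF≡c∧all≡c⇒ℓ≡1 ℓ f c Σf≡c fⱼ≡c = *-cancelʳ-≡ ℓ 1 c (begin
  ℓ * c            ≡⟨ sumF-const ℓ c ⟨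
  sumF ℓ (λ _ → c) ≡⟨ sumF-cong ℓ fⱼ≡c ⟨
  sumF ℓ f         ≡⟨ Σf≡c ⟩
  c                ≡⟨ *-identityˡ c ⟨
  1 * c            ∎)
  where open ≡-Reasoning

single-block-equality : ∀ {ℓ} s (m : Fin ℓ → ℕ) → ℓ ≡ 1 × (∀ j → m j ≡ s) →
                        3 ^ (s ∸ 1) * prodF ℓ m ≡ 3 ^ sumF ℓ (λ j → m j ∸ 1) * s
single-block-equality s m (refl , mⱼ≡s) rewrite mⱼ≡s zero =
  cong₂ _*_ (cong (3 ^_) (sym (+-identityʳ (s ∸ 1)))) (*-identityʳ s)

claim3p2 : (s ℓ : ℕ) → 2 ≤ s → 1 ≤ ℓ → ℓ ≤ s C 2 →
           (m : Fin ℓ → ℕ) → (∀ j → 2 ≤ m j × m j ≤ s) →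
           sumF ℓ (λ j → m j C 2) ≡ s C 2 →
           (3 ^ (s ∸ 1) * prodF ℓ m ≤ 3 ^ sumF ℓ (λ j → m j ∸ 1) * s)
           × ((3 ^ (s ∸ 1) * prodF ℓ m ≡ 3 ^ sumF ℓ (λ j → m j ∸ 1) * s)
              ⇔ (ℓ ≡ 1 × (∀ j → m j ≡ s)))
claim3p2 s ℓ 2≤s _ _ m bounds Σ[mⱼC2]≡sC2 =
  L≤R , mk⇔ (λ L≡R → ℓ≡1 (mⱼ≡s L≡R) , mⱼ≡s L≡R) (single-block-equality s m)
  where
  instance
    s*[s∸1]≢0 : NonZero (s * (s ∸ 1))
    s*[s∸1]≢0 = ψ-deg-nonZero 2≤s
  L R : ℕ
  L = 3 ^ (s ∸ 1) * prodF ℓ m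
  R = 3 ^ sumF ℓ (λ j → m j ∸ 1) * s
  Σdeg : sumF ℓ (λ j → m j * (m j ∸ 1)) ≡ s * (s ∸ 1)
  Σdeg = sumF-[nC2]≡⇒sumF-n*[n∸1]≡ ℓ m s Σ[mⱼC2]≡sC2
  ≡L : prodF ℓ m * 3 ^ (s ∸ 1) ≡ L
  ≡L = *-comm (prodF ℓ m) (3 ^ (s ∸ 1))
  ≡R : prodF ℓ (λ j → 3 ^ (m j ∸ 1)) * s ≡ R
  ≡R = cong (_* s) (prodF-^-sumF ℓ 3 (λ j → m j ∸ 1))
  ψmⱼ≤ψs : ∀ j → ψ (m j) ≤ᴿ ψ s
  ψmⱼ≤ψs j = ψ-≤ᴿ (proj₁ (bounds j)) (proj₂ (bounds j))
  L≤R : L ≤ R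
  L≤R = subst₂ _≤_ ≡L ≡R (prodF-≤ᴿ ℓ Σdeg ψmⱼ≤ψs)
  L<R : ∀ i → m i ≢ s → L < R
  L<R i mᵢ≢s = subst₂ _<_ ≡L ≡R
    (prodF-<ᴿ ℓ Σdeg (λ j → m^n>0 3 (m j ∸ 1)) (≤-trans (s≤s z≤n) 2≤s) ψmⱼ≤ψs i
              (ψ-<ᴿ (proj₁ (bounds i)) (≤∧≢⇒< (proj₂ (bounds i)) mᵢ≢s)))
  mⱼ≡s : L ≡ R → ∀ j → m j ≡ s
  mⱼ≡s L≡R j with m j ≟ s
  ... | yes mⱼ≡s = mⱼ≡s
  ... | no  mⱼ≢s = contradiction L≡R (<⇒≢ (L<R j mⱼ≢s))
  ℓ≡1 : (∀ j → m j ≡ s) → ℓ ≡ 1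
  ℓ≡1 all-s = sumF≡c∧all≡c⇒ℓ≡1 ℓ _ (s * (s ∸ 1)) Σdeg (λ j → cong (λ t → t * (t ∸ 1)) (all-s j))
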